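{- Let $G$ be a $k$-colorable graph. Then for every assignment to the vertices of $G$ of lists $L(v)=\{\gamma(v),\gamma(v)+1,\dots,\gamma(v)+k-1\}$, each an interval of $k$ consecutive integers, $G$ admits a proper coloring $c$ with $c(v)\in L(v)$ for all $v\in V(G)$. Consequently every $k$-colorable graph is $k$-$(\gamma,\mu)$-colorable.
   Context: A graph is $k$-$(\gamma,\mu)$-colorable if it admits a proper coloring selecting one color from each list under every assignment of integer intervals $[\gamma(v),\mu(v)]$ with $\mu(v)-\gamma(v)+1=k$ to its vertices. -}

module Defs where

open import Level using (0ℓ)
open import Data.Nat using (ℕ; suc)
open import Data.Fin using (Fin)
open import Data.Integer using (ℤ; _+_; _≤_; +_; _-_)
open import Data.Product using (Σ; _×_; ∃)
open import Relation.Nullary using (¬_)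
open import Relation.Binary.PropositionalEquality using (_≡_)

record Graph (n : ℕ) : Set₁ where
  field
    Adj    : Fin n → Fin n → Set
    sym    : ∀ {u v} → Adj u v → Adj v u
    irrefl : ∀ {v} → ¬ Adj v v
open Graph public

Proper : ∀ {n} {C : Set} → Graph n → (Fin n → C) → Set
Proper G c = ∀ u v → Adj G u v → ¬ (c u ≡ c v)

Colorable : ∀ {n} → ℕ → Graph n → Set
Colorable {n} k G = ∃ λ (c : Fin n → Fin k) → Proper G c

InInterval : ℤ → ℤ → ℤ → Set
InInterval a b c = (a ≤ c) × (c ≤ b)

GammaMuColorable : ∀ {n} → ℕ → Graph n → Set
GammaMuColorable {n} k G =
  (γ μ : Fin n → ℤ) → (∀ v → (μ v - γ v) + + 1 ≡ + k) →
  ∃ λ (c : Fin n → ℤ) → Proper G c × (∀ v → InInterval (γ v) (μ v) (c v))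

{-# OPTIONS --safe #-}
-- Take a proper colouring f with colours 0, …, k − 1 and recolour each vertex v
-- by the unique element of its list [γ(v), γ(v) + k − 1] congruent to f(v)
-- modulo k. Two colours f(u), f(v) in [0, k) that are congruent modulo k are
-- equal, so adjacent vertices still receive different colours.
module Submission where

open import Defs using (Graph; Proper; Colorable; InInterval; GammaMuColorable)
open import Data.Nat using (ℕ; zero; suc; NonZero)
import Data.Nat as ℕ
import Data.Nat.Properties as ℕ
open import Data.Fin using (Fin; toℕ)
open import Data.Fin.Properties using (toℕ<n; toℕ-injective; ¬Fin0)
open import Data.Integer using (ℤ; _+_; _-_; +_; _*_; _⊖_; ∣_∣; 0ℤ; -1ℤ; _≤_; +<+)
open import Data.Integer.Properties
  using (∣i*j∣≡∣i∣*∣j∣; m-n≡m⊖n; ∣m⊝n∣≤m⊔n; ∣i∣≡0⇒i≡0; *-zeroˡ; i-j≡0⇒i≡j; +-injective;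
         i≤i+j; +-monoʳ-<; i<j⇒i≤pred[j]; +-comm; +-assoc)
open import Data.Integer.DivMod using (_%ℕ_; _/ℕ_; a≡a%ℕn+[a/ℕn]*n; n%ℕd<d)
open import Data.Integer.Tactic.RingSolver using (solve; solve-∀)
open import Data.Product using (∃; _×_; _,_)
open import Data.Empty using (⊥-elim)
open import Data.List using ([]; _∷_)
open import Relation.Binary.PropositionalEquality using (_≡_; sym; trans; cong; cong₂; subst)
open import Relation.Binary.PropositionalEquality as ≡ using ()

congruent-below⇒≡ : ∀ {a b d} (w : ℤ) → a ℕ.< d → b ℕ.< d → + a - + b ≡ w * + d → a ≡ b
congruent-below⇒≡ {a} {b} {d} w a<d b<d a-b≡wd =
  +-injective (i-j≡0⇒i≡j (+ a) (+ b) (trans a-b≡wd (trans (cong (_* + d) w≡0) (*-zeroˡ (+ d)))))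
  where
  ∣w∣*d<d : ∣ w ∣ ℕ.* d ℕ.< 1 ℕ.* d
  ∣w∣*d<d = begin-strict
    ∣ w ∣ ℕ.* d   ≡⟨ ∣i*j∣≡∣i∣*∣j∣ w (+ d) ⟨
    ∣ w * + d ∣   ≡⟨ cong ∣_∣ (trans (sym a-b≡wd) (m-n≡m⊖n a b)) ⟩
    ∣ a ⊖ b ∣     ≤⟨ ∣m⊝n∣≤m⊔n a b ⟩
    a ℕ.⊔ b       <⟨ ℕ.⊔-lub a<d b<d ⟩
    d             ≡⟨ ℕ.*-identityˡ d ⟨
    1 ℕ.* d       ∎
    where open ℕ.≤-Reasoning

  w≡0 : w ≡ 0ℤ
  w≡0 = ∣i∣≡0⇒i≡0 (ℕ.n<1⇒n≡0 (ℕ.*-cancelʳ-< d ∣ w ∣ 1 ∣w∣*d<d))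

module Window (d : ℕ) .{{_ : NonZero d}} where

  representative : ℤ → ℤ → ℤ
  representative γ a = γ + + ((a - γ) %ℕ d)

  representative-≥ : ∀ γ a → γ ≤ representative γ a
  representative-≥ γ a = i≤i+j γ (+ ((a - γ) %ℕ d))

  representative-≤ : ∀ γ a → representative γ a ≤ (γ + + d) - + 1
  representative-≤ γ a = subst (representative γ a ≤_) (+-comm -1ℤ (γ + + d))
    (i<j⇒i≤pred[j] (+-monoʳ-< γ (+<+ (n%ℕd<d (a - γ) d))))

  ≡representative+quotient : ∀ γ a → a ≡ representative γ a + ((a - γ) /ℕ d) * + d
  ≡representative+quotient γ a = begin
    a                                           ≡⟨ solve (a ∷ γ ∷ []) ⟩
    γ + (a - γ)                                 ≡⟨ cong (_+_ γ) (a≡a%ℕn+[a/ℕn]*n (a - γ) d) ⟩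
    γ + (+ ((a - γ) %ℕ d) + ((a - γ) /ℕ d) * + d) ≡⟨ +-assoc γ _ _ ⟨
    representative γ a + ((a - γ) /ℕ d) * + d   ∎
    where open ≡.≡-Reasoning

  representative-injective : ∀ γ δ {a b} → a ℕ.< d → b ℕ.< d →
                             representative γ (+ a) ≡ representative δ (+ b) → a ≡ b
  representative-injective γ δ {a} {b} a<d b<d r≡s = congruent-below⇒≡ (q - p) a<d b<d (begin
    + a - + b                      ≡⟨ cong₂ _-_ (≡representative+quotient γ (+ a))
                                                (≡representative+quotient δ (+ b)) ⟩
    (r + q * + d) - (s + p * + d)  ≡⟨ cong (λ x → (r + q * + d) - (x + p * + d)) r≡s ⟨
    (r + q * + d) - (r + p * + d)  ≡⟨ cancel-common-term r q p (+ d) ⟩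
    (q - p) * + d                  ∎)
    where
    open ≡.≡-Reasoning
    r s q p : ℤ
    r = representative γ (+ a)
    s = representative δ (+ b)
    q = (+ a - γ) /ℕ d
    p = (+ b - δ) /ℕ d

    cancel-common-term : ∀ x i j e → (x + i * e) - (x + j * e) ≡ (i - j) * e
    cancel-common-term = solve-∀

proper-if-finer : ∀ {n} {A B : Set} (G : Graph n) {f : Fin n → A} {c : Fin n → B} →
                  Proper G f → (∀ u v → c u ≡ c v → f u ≡ f v) → Proper G c
proper-if-finer G f-proper c-finer u v u~v cu≡cv = f-proper u v u~v (c-finer u v cu≡cv)

window-colorable : ∀ {n} k (G : Graph n) → Colorable k G → (γ : Fin n → ℤ) →
  ∃ λ (c : Fin n → ℤ) → Proper G c × (∀ v → InInterval (γ v) ((γ v + + k) - + 1) (c v))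
window-colorable zero G (f , _) γ = γ , (λ u _ _ _ → ¬Fin0 (f u)) , λ v → ⊥-elim (¬Fin0 (f v))
window-colorable k@(suc _) G (f , f-proper) γ =
  c , proper-if-finer G f-proper c-determines-f , c∈window
  where
  open Window k
  c : Fin _ → ℤ
  c v = representative (γ v) (+ toℕ (f v))

  c∈window : ∀ v → InInterval (γ v) ((γ v + + k) - + 1) (c v)
  c∈window v = representative-≥ (γ v) (+ toℕ (f v)) , representative-≤ (γ v) (+ toℕ (f v))

  c-determines-f : ∀ u v → c u ≡ c v → f u ≡ f v
  c-determines-f u v cu≡cv =
    toℕ-injective (representative-injective (γ u) (γ v) (toℕ<n (f u)) (toℕ<n (f v)) cu≡cv)

length≡⇒upper-end : ∀ γ μ k → (μ - γ) + + 1 ≡ + k → (γ + + k) - + 1 ≡ μ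
length≡⇒upper-end γ μ k length≡k = begin
  (γ + + k) - + 1              ≡⟨ cong (λ x → (γ + x) - + 1) length≡k ⟨
  (γ + ((μ - γ) + + 1)) - + 1  ≡⟨ solve (γ ∷ μ ∷ []) ⟩
  μ                            ∎
  where open ≡.≡-Reasoning

theorem4 : ∀ {n} (k : ℕ) (G : Graph n) → Colorable k G →
    ((γ : Fin n → ℤ) →
      ∃ λ (c : Fin n → ℤ) → Proper G c × (∀ v → InInterval (γ v) ((γ v + + k) - + 1) (c v)))
    × GammaMuColorable k G
theorem4 k G colorable = window-colorable k G colorable , gamma-mu-colorable
  where
  gamma-mu-colorable : GammaMuColorable k G
  gamma-mu-colorable γ μ length≡k =
    let c , c-proper , c∈window = window-colorable k G colorable γ in
    c , c-proper , λ v → subst (λ μv → InInterval (γ v) μv (c v))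
                               (length≡⇒upper-end (γ v) (μ v) k (length≡k v)) (c∈window v)
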